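{- Let $G$ be a connected simple graph of order $n\geq 2$ and size $m\geq 1$, let $S\subseteq V(G)$ with $|S|=\sigma$, and let $G_S$ be the self-loop graph obtained from $G$ by attaching one loop at each vertex of $S$. Then the number of closed walks of length $4$ in $G_S$ is \[ w_4^{cl}(G_S)=\sigma+2\big(M_1(G)-m\big)+6\sum_{v\in S}d_G(v)-2\sum_{v\in S}n_1(v) +8\big(n_{\triangle_1}(G_S)+2n_{\triangle_2}(G_S)+3n_{\triangle_3}(G_S)+n_\square(G)+3n_\boxtimes(G)\big), \] where $M_1(G)=\sum_{v\in V(G)}d_G(v)^2$ is the first Zagreb index of $G$.
   Context: A self-loop graph $G_S$ is obtained from a simple graph $G$ by attaching exactly one loop at each vertex of $S\subseteq V(G)$. A walk of length $k$ in $G_S$ is a sequence of (not necessarily distinct) vertices $v_0,\dots,v_k$ such that for each $i$, either $v_{i-1}v_i\in E(G)$, or $v_{i-1}=v_i\in S$ (traversing the loop); it is closed if $v_k=v_0$, and $w_k^{cl}(G_S)$ is the number of closed walks of length $k$ (equivalently, the trace of $A(G_S)^k$, with $A(G_S)$ the adjacency matrix of $G$ with diagonal entry $1$ at vertices of $S$). $d_G(v)$ is the degree of $v$ in $G$. For $v\in S$, $n_1(v)$ is the number of neighbours of $v$ in $G$ that are not in $S$. For $r=1,2,3$, $n_{\triangle_r}(G_S)$ is the number of triangles of $G$ having exactly $r$ vertices in $S$ and $3-r$ vertices in $V(G)\setminus S$. $n_\boxtimes(G)$ is the number of complete subgraphs $K_4$ in $G$, and $n_\square(G)$ is the number of $4$-cycles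 $C_4$ in $G$ that are not contained in a $K_4$ of $G$ (i.e., the $4$-cycles lying in some $K_4$ are not counted in $n_\square$; they are accounted for by $n_\boxtimes$). -}

module Defs where

open import Data.Nat using (ℕ; zero; suc; _+_; _*_; _<_; _≤_)
open import Data.Bool using (Bool; true; false; if_then_else_; not; _∧_)
open import Data.Fin using (Fin; toℕ) renaming (zero to fz; suc to fs)
open import Data.Fin.Subset using (Subset; inside; outside)
open import Data.Vec using (lookup)
open import Relation.Binary.PropositionalEquality using (_≡_)
open import Relation.Nullary.Decidable using (⌊_⌋)
open import Data.Fin using (_≟_)
import Data.Nat as N
open import Data.Product using (∃)

record Graph (n : ℕ) : Set where
  field
    adj  : Fin n → Fin n → Bool
    sym  : ∀ u v → adj u v ≡ adj v u
    irr  : ∀ v → adj v v ≡ false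
open Graph public

ι : Bool → ℕ
ι true  = 1
ι false = 0

Σ : (n : ℕ) → (Fin n → ℕ) → ℕ
Σ zero    f = 0
Σ (suc n) f = f fz + Σ n (λ i → f (fs i))

_<ᵇ_ : ∀ {n} → Fin n → Fin n → Bool
i <ᵇ j = ⌊ toℕ i N.<? toℕ j ⌋

inS : ∀ {n} → Subset n → Fin n → Bool
inS S v = lookup S v

data Reach {n : ℕ} (G : Graph n) : Fin n → Fin n → Set where
  here : ∀ {v} → Reach G v v
  step : ∀ {u w v} → adj G u w ≡ true → Reach G w v → Reach G u v

Connected : ∀ {n} → Graph n → Set
Connected {n} G = ∀ (u v : Fin n) → Reach G u v

module _ {n : ℕ} (G : Graph n) where
  e : Fin n → Fin n → ℕ
  e u v = ι (adj G u v)

  deg : Fin n → ℕ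
  deg v = Σ n (λ w → e v w)

  size : ℕ
  size = Σ n λ i → Σ n λ j → ι (i <ᵇ j) * e i j

  M1 : ℕ
  M1 = Σ n λ v → deg v * deg v

  nK4 : ℕ
  nK4 = Σ n λ i → Σ n λ j → Σ n λ k → Σ n λ l →
          ι (i <ᵇ j) * ι (j <ᵇ k) * ι (k <ᵇ l) *
          (e i j * e i k * e i l * e j k * e j l * e k l)

  cyc : Fin n → Fin n → Fin n → Fin n → ℕ
  cyc a b c d = e a b * e b c * e c d * e d a

  -- number of 4-cycles of G not contained in a K4: for each 4-set
  -- i<j<k<l the three distinct 4-cycles on it are i-j-k-l, i-j-l-k, i-k-j-l;
  -- they count only if {i,j,k,l} does not span a K4 (i.e. one of the two
  -- "diagonal" pairs of the respective cycle is a non-edge).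
  nC4 : ℕ
  nC4 = Σ n λ i → Σ n λ j → Σ n λ k → Σ n λ l →
          ι (i <ᵇ j) * ι (j <ᵇ k) * ι (k <ᵇ l) *
          (ι (not (adj G i j ∧ adj G i k ∧ adj G i l ∧
                   adj G j k ∧ adj G j l ∧ adj G k l)) *
           (cyc i j k l + cyc i j l k + cyc i k j l))

  module _ (S : Subset n) where
    stepS : Fin n → Fin n → ℕ
    stepS u v = e u v + (if ⌊ u ≟ v ⌋ then ι (inS S u) else 0)

    walks : ℕ → Fin n → Fin n → ℕ
    walks zero    u v = ι ⌊ u ≟ v ⌋
    walks (suc k) u v = Σ n λ w → stepS u w * walks k w v

    wcl : ℕ → ℕ
    wcl k = Σ n λ v → walks k v v

    σ : ℕ
    σ = Σ n λ v → ι (inS S v)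

    n1 : Fin n → ℕ
    n1 v = Σ n λ w → e v w * ι (not (inS S w))

    sumDegS : ℕ
    sumDegS = Σ n λ v → ι (inS S v) * deg v

    sumN1S : ℕ
    sumN1S = Σ n λ v → ι (inS S v) * n1 v

    nTri : ℕ → ℕ
    nTri r = Σ n λ i → Σ n λ j → Σ n λ k →
               ι (i <ᵇ j) * ι (j <ᵇ k) * (e i j * e j k * e i k) *
               ι ⌊ (ι (inS S i) + ι (inS S j) + ι (inS S k)) N.≟ r ⌋

-- Write A = E + L, where E is the adjacency matrix of G and L the diagonal matrix of the
-- loops; closed walks of length 4 in G_S are counted by tr A⁴.  By cyclicity of the trace
-- the sixteen words in E and L fall into six rotation classes, and every factor L
-- collapses one summation: LEEE counts each pair (triangle, vertex of S on it) twice,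
-- LLEE the edges at vertices of S, LELE the ordered pairs of adjacent vertices of S
-- (which together with n₁ again make up the degrees in S), LLLE vanishes and LLLL = σ.  In
-- tr E⁴ a closed walk v w x y with v = x or w = y contributes, by inclusion–exclusion,
-- 2 M₁ − 2m in total; the remaining walks run through four distinct vertices, and each
-- 4-cycle is traversed in 8 ways.  Ordered tuples of distinct vertices are related to the
-- increasing tuples of the definitions by sorting: of k distinct elements exactly one is
-- least, and the others are sorted recursively.

module Submission where

open import Data.Nat using (ℕ; _≤_)
import Data.Nat as ℕ
open import Data.Fin.Subset using (Subset)
open import Relation.Binary.PropositionalEquality using (_≡_; refl; sym; trans; cong; cong₂)
open import Defs renaming (sym to adj-sym)

module Counting where

  open import Data.Nat using (zero; suc; _+_; _*_; s≤s; z≤n)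
  open import Data.Nat.Properties
    using ( +-*-semiring; *-commutativeSemigroup; *-comm; *-assoc; +-comm
          ; *-identityʳ; +-identityʳ; *-zeroʳ; *-distribʳ-+; *-distribˡ-+; +-mono-≤ )
  open import Algebra.Properties.CommutativeSemigroup *-commutativeSemigroup
    using (x∙yz≈y∙xz; xy∙z≈xz∙y)
  open import Algebra.Properties.Semiring.Sum +-*-semiring
    using (sum; sum-cong-≗; sum-replicate-zero; ∑-distrib-+; ∑-comm; *-distribˡ-sum)
  open import Data.Bool using (Bool; true; false; if_then_else_; not; _∧_)
  open import Data.Fin using (Fin; toℕ; _≟_) renaming (zero to fz; suc to fs)
  open import Data.List using (List; []; _∷_; map; cartesianProduct)
  import Data.Nat.ListAction as List
  open import Data.Product using (_×_; _,_)
  open import Function using (_∘_)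
  open import Relation.Nullary using (does; yes; no)
  open import Relation.Nullary.Decidable using (⌊_⌋; isYes≗does)
  open import Relation.Binary.PropositionalEquality using (_≗_; module ≡-Reasoning)
  open import Data.Nat.Tactic.RingSolver using (solve; solve-∀)
  open ≡-Reasoning

  Σ≡sum : ∀ n (f : Fin n → ℕ) → Σ n f ≡ sum f
  Σ≡sum zero    f = refl
  Σ≡sum (suc n) f = cong (f fz +_) (Σ≡sum n (f ∘ fs))

  Σ-zero : ∀ n → Σ n (λ _ → 0) ≡ 0
  Σ-zero n = trans (Σ≡sum n _) (sum-replicate-zero n)

  -- Indicators are ℕ-valued, so that counting arguments become semiring identities.

  lt : ∀ {n} → Fin n → Fin n → ℕ
  lt i j = ι (toℕ i ℕ.<ᵇ toℕ j)

  ne : ∀ {n} → Fin n → Fin n → ℕ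
  ne i j = lt i j + lt j i

  δ : ∀ {n} → Fin n → Fin n → ℕ
  δ i j = ι (does (i ≟ j))

  distinct₃ : ∀ {n} → Fin n → Fin n → Fin n → ℕ
  distinct₃ i j k = ne i j * ne i k * ne j k

  distinct₄ : ∀ {n} → Fin n → Fin n → Fin n → Fin n → ℕ
  distinct₄ i j k l = ne i j * ne i k * ne i l * distinct₃ j k l

  least₃ : ∀ {n} → Fin n → Fin n → Fin n → ℕ
  least₃ i j k = lt i j * lt i k * ne j k

  least₄ : ∀ {n} → Fin n → Fin n → Fin n → Fin n → ℕ
  least₄ i j k l = lt i j * lt i k * lt i l * distinct₃ j k l

  ι-<ᵇ : ∀ {n} (i j : Fin n) → ι (i <ᵇ j) ≡ lt i j
  ι-<ᵇ i j = cong ι (isYes≗does (toℕ i ℕ.<? toℕ j))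

  ι-≟ : ∀ {n} (i j : Fin n) → ι ⌊ i ≟ j ⌋ ≡ δ i j
  ι-≟ i j = cong ι (isYes≗does (i ≟ j))

  δ-refl : ∀ {n} (i : Fin n) → δ i i ≡ 1
  δ-refl fz     = refl
  δ-refl (fs i) = δ-refl i

  δ-sym : ∀ {n} (i j : Fin n) → δ i j ≡ δ j i
  δ-sym fz     fz     = refl
  δ-sym fz     (fs j) = refl
  δ-sym (fs i) fz     = refl
  δ-sym (fs i) (fs j) = δ-sym i j

  δ+ne≡1 : ∀ {n} (i j : Fin n) → δ i j + ne i j ≡ 1
  δ+ne≡1 fz     fz     = refl
  δ+ne≡1 fz     (fs j) = refl
  δ+ne≡1 (fs i) fz     = refl
  δ+ne≡1 (fs i) (fs j) = δ+ne≡1 i j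

  x+0+0≡x : ∀ x → x + 0 + 0 ≡ x
  x+0+0≡x x = trans (+-identityʳ (x + 0)) (+-identityʳ x)

  Σ-δ : ∀ {n} (i : Fin n) (f : Fin n → ℕ) → Σ n (λ j → δ i j * f j) ≡ f i
  Σ-δ {suc n} fz     f = trans (cong (f fz + 0 +_) (Σ-zero n)) (x+0+0≡x (f fz))
  Σ-δ {suc n} (fs i) f = Σ-δ i (f ∘ fs)

  distinct₃-by-least : ∀ {n} (i j k : Fin n) →
    distinct₃ i j k ≡ least₃ i j k + least₃ j i k + least₃ k i j
  distinct₃-by-least fz     fz     k      = refl
  distinct₃-by-least fz     (fs j) fz     = refl
  distinct₃-by-least fz     (fs j) (fs k) with lt j k | lt k j
  ... | a | b = solve (a ∷ b ∷ [])
  distinct₃-by-least (fs i) fz     fz     = refl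
  distinct₃-by-least (fs i) fz     (fs k) with lt i k | lt k i
  ... | a | b = solve (a ∷ b ∷ [])
  distinct₃-by-least (fs i) (fs j) fz     with lt i j | lt j i
  ... | a | b = solve (a ∷ b ∷ [])
  distinct₃-by-least (fs i) (fs j) (fs k) = distinct₃-by-least i j k

  distinct₄-by-least : ∀ {n} (i j k l : Fin n) →
    distinct₄ i j k l ≡ least₄ i j k l + least₄ j i k l + least₄ k i j l + least₄ l i j k
  distinct₄-by-least fz     fz     k      l      = refl
  distinct₄-by-least fz     (fs j) fz     l      = refl
  distinct₄-by-least fz     (fs j) (fs k) fz     with lt j k | lt k j
  ... | a | b = solve (a ∷ b ∷ [])
  distinct₄-by-least fz     (fs j) (fs k) (fs l) with lt j k | lt k j | lt j l | lt l j | lt k l | lt l k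
  ... | a | b | c | d | e | f = solve (a ∷ b ∷ c ∷ d ∷ e ∷ f ∷ [])
  distinct₄-by-least (fs i) fz     fz     fz     = refl
  distinct₄-by-least (fs i) fz     fz     (fs l) with lt i l | lt l i
  ... | a | b = solve (a ∷ b ∷ [])
  distinct₄-by-least (fs i) fz     (fs k) fz     with lt i k | lt k i
  ... | a | b = solve (a ∷ b ∷ [])
  distinct₄-by-least (fs i) fz     (fs k) (fs l) with lt i k | lt k i | lt i l | lt l i | lt k l | lt l k
  ... | a | b | c | d | e | f = solve (a ∷ b ∷ c ∷ d ∷ e ∷ f ∷ [])
  distinct₄-by-least (fs i) (fs j) fz     fz     with lt i j | lt j i
  ... | a | b = solve (a ∷ b ∷ [])
  distinct₄-by-least (fs i) (fs j) fz     (fs l) with lt i j | lt j i | lt i l | lt l i | lt j l | lt l j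
  ... | a | b | c | d | e | f = solve (a ∷ b ∷ c ∷ d ∷ e ∷ f ∷ [])
  distinct₄-by-least (fs i) (fs j) (fs k) fz     with lt i j | lt j i | lt i k | lt k i | lt j k | lt k j
  ... | a | b | c | d | e | f = solve (a ∷ b ∷ c ∷ d ∷ e ∷ f ∷ [])
  distinct₄-by-least (fs i) (fs j) (fs k) (fs l) = distinct₄-by-least i j k l

  lt-chain₃ : ∀ {n} (i j k : Fin n) → lt i j * lt i k * lt j k ≡ lt i j * lt j k
  lt-chain₃ fz     fz     k      = refl
  lt-chain₃ fz     (fs j) fz     = refl
  lt-chain₃ fz     (fs j) (fs k) = refl
  lt-chain₃ (fs i) fz     k      = refl
  lt-chain₃ (fs i) (fs j) fz     with lt i j
  ... | a = solve (a ∷ [])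
  lt-chain₃ (fs i) (fs j) (fs k) = lt-chain₃ i j k

  lt-chain₄ : ∀ {n} (i j k l : Fin n) →
    lt i j * lt i k * lt i l * (lt j k * lt k l) ≡ lt i j * lt j k * lt k l
  lt-chain₄ fz     fz     k      l      = refl
  lt-chain₄ fz     (fs j) fz     l      = refl
  lt-chain₄ fz     (fs j) (fs k) fz     with lt j k
  ... | a = solve (a ∷ [])
  lt-chain₄ fz     (fs j) (fs k) (fs l) with lt j k | lt k l
  ... | a | b = solve (a ∷ b ∷ [])
  lt-chain₄ (fs i) fz     k      l      = refl
  lt-chain₄ (fs i) (fs j) fz     l      with lt i j | lt fz l
  ... | a | b = solve (a ∷ b ∷ [])
  lt-chain₄ (fs i) (fs j) (fs k) fz     with lt i j | lt i k | lt j k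
  ... | a | b | c = solve (a ∷ b ∷ c ∷ [])
  lt-chain₄ (fs i) (fs j) (fs k) (fs l) = lt-chain₄ i j k l

  ι-idem : ∀ b → ι b * ι b ≡ ι b
  ι-idem true  = refl
  ι-idem false = refl

  ι-≤1 : ∀ b → ι b ≤ 1
  ι-≤1 true  = s≤s z≤n
  ι-≤1 false = z≤n

  count-by-value : ∀ m → m ≤ 3 →
                   ι ⌊ m ℕ.≟ 1 ⌋ + 2 * ι ⌊ m ℕ.≟ 2 ⌋ + 3 * ι ⌊ m ℕ.≟ 3 ⌋ ≡ m
  count-by-value 0 _ = refl
  count-by-value 1 _ = refl
  count-by-value 2 _ = refl
  count-by-value 3 _ = refl
  count-by-value (suc (suc (suc (suc _)))) (s≤s (s≤s (s≤s ())))

  K4-split : ∀ a b c d e f →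
    let C = ι a * ι d * ι f * ι c + ι a * ι e * ι f * ι b + ι b * ι d * ι e * ι c in
    ι (not (a ∧ b ∧ c ∧ d ∧ e ∧ f)) * C + 3 * (ι a * ι b * ι c * ι d * ι e * ι f) ≡ C
  K4-split true  true  true  true  true  true  = refl
  K4-split false b     c     d     e     f     = x+0+0≡x _
  K4-split true  false c     d     e     f     = x+0+0≡x _
  K4-split true  true  false d     e     f     = x+0+0≡x _
  K4-split true  true  true  false e     f     = x+0+0≡x _
  K4-split true  true  true  true  false f     = x+0+0≡x _
  K4-split true  true  true  true  true  false = x+0+0≡x _

  neighbour-split : ∀ a b c → ι a * (ι c * ι (not b)) + ι c * ι b * (ι c * ι a) ≡ ι a * ι c
  neighbour-split true  true  true  = refl
  neighbour-split true  true  false = refl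
  neighbour-split true  false true  = refl
  neighbour-split true  false false = refl
  neighbour-split false true  true  = refl
  neighbour-split false true  false = refl
  neighbour-split false false true  = refl
  neighbour-split false false false = refl

  inclusion-exclusion : ∀ x {a a′ b b′} → a + a′ ≡ 1 → b + b′ ≡ 1 →
                        x + x * a * b ≡ x * a + x * b + x * a′ * b′
  inclusion-exclusion x {a} {a′} {b} {b′} a+a′≡1 b+b′≡1 = begin
    x + x * a * b
      ≡⟨ cong (_+ x * a * b) (trans (cong₂ (λ p q → x * p * q) a+a′≡1 b+b′≡1) (x*1*1 x)) ⟨
    x * (a + a′) * (b + b′) + x * a * b
      ≡⟨ expand x a a′ b b′ ⟩
    x * a * (b + b′) + x * (a + a′) * b + x * a′ * b′
      ≡⟨ cong₂ (λ p q → x * a * q + x * p * b + x * a′ * b′) a+a′≡1 b+b′≡1 ⟩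
    x * a * 1 + x * 1 * b + x * a′ * b′
      ≡⟨ tidy x a b (x * a′ * b′) ⟩
    x * a + x * b + x * a′ * b′ ∎
    where
    x*1*1 : ∀ x → x * 1 * 1 ≡ x
    x*1*1 = solve-∀
    expand : ∀ x a a′ b b′ →
      x * (a + a′) * (b + b′) + x * a * b ≡ x * a * (b + b′) + x * (a + a′) * b + x * a′ * b′
    expand = solve-∀
    tidy : ∀ x a b c → x * a * 1 + x * 1 * b + c ≡ x * a + x * b + c
    tidy = solve-∀

  *-absorb₃ : ∀ {a b c p q r : ℕ} → a * p ≡ a → b * q ≡ b → c * r ≡ c →
              a * b * c ≡ p * q * r * (a * b * c)
  *-absorb₃ {a} {b} {c} {p} {q} {r} ap≡a bq≡b cr≡c =
    sym (trans (shuffle p q r a b c) (cong₂ _*_ (cong₂ _*_ ap≡a bq≡b) cr≡c))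
    where
    shuffle : ∀ p q r a b c → p * q * r * (a * b * c) ≡ a * p * (b * q) * (c * r)
    shuffle = solve-∀

  *-absorb₄ : ∀ {a b c d p q r t : ℕ} → a * p ≡ a → b * q ≡ b → c * r ≡ c → d * t ≡ d →
              a * b * c * d ≡ p * q * r * t * (a * b * c * d)
  *-absorb₄ {a} {b} {c} {d} {p} {q} {r} {t} ap≡a bq≡b cr≡c dt≡d =
    sym (trans (shuffle p q r t a b c d) (cong₂ _*_ (cong₂ _*_ (cong₂ _*_ ap≡a bq≡b) cr≡c) dt≡d))
    where
    shuffle : ∀ p q r t a b c d → p * q * r * t * (a * b * c * d) ≡ a * p * (b * q) * (c * r) * (d * t)
    shuffle = solve-∀

  uncurry₄ : {A B : Set} → (A → A → A → A → B) → A × A × A × A → B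
  uncurry₄ t (a , b , c , d) = t a b c d

  quadruples : {A : Set} → A → A → List (A × A × A × A)
  quadruples x y = cartesianProduct xy (cartesianProduct xy (cartesianProduct xy xy))
    where xy = x ∷ y ∷ []

  -- The coefficients are the sizes of the rotation classes of the words of length 4 in x, y.
  cyclic-binomial : {A : Set} (t : A → A → A → A → ℕ) → (∀ a b c d → t a b c d ≡ t b c d a) →
    (x y : A) → List.sum (map (uncurry₄ t) (quadruples x y)) ≡
    t x x x x + 4 * t y x x x + 4 * t y y x x + 2 * t y x y x + 4 * t y y y x + t y y y y
  cyclic-binomial t rot x y
    -- successive rotations carry every word to the representative of its class
    rewrite rot x x x y | rot x x y x | rot x y x x
          | rot y x x y | rot x x y y | rot x y y x
          | rot x y x y
          | rot y y x y | rot y x y y | rot x y y y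
    with t x x x x | t y x x x | t y y x x | t y x y x | t y y y x | t y y y y
  ... | a | b | c | d | e | f = solve (a ∷ b ∷ c ∷ d ∷ e ∷ f ∷ [])

  Mat : ℕ → Set
  Mat n = Fin n → Fin n → ℕ

  module _ {n : ℕ} where

    Σ-cong : {f g : Fin n → ℕ} → f ≗ g → Σ n f ≡ Σ n g
    Σ-cong {f} {g} f≗g = trans (Σ≡sum n f) (trans (sum-cong-≗ f≗g) (sym (Σ≡sum n g)))

    Σ-+ : (f g : Fin n → ℕ) → Σ n (λ i → f i + g i) ≡ Σ n f + Σ n g
    Σ-+ f g = trans (Σ≡sum n _) (trans (∑-distrib-+ f g) (sym (cong₂ _+_ (Σ≡sum n f) (Σ≡sum n g))))

    Σ-*ˡ : (c : ℕ) (f : Fin n → ℕ) → Σ n (λ i → c * f i) ≡ c * Σ n f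
    Σ-*ˡ c f = trans (Σ≡sum n _) (sym (trans (cong (c *_) (Σ≡sum n f)) (*-distribˡ-sum c f)))

    Σ-*ʳ : (c : ℕ) (f : Fin n → ℕ) → Σ n (λ i → f i * c) ≡ Σ n f * c
    Σ-*ʳ c f = trans (Σ-cong λ i → *-comm (f i) c) (trans (Σ-*ˡ c f) (*-comm c _))

    Σ-comm : (f : Fin n → Fin n → ℕ) →
             Σ n (λ i → Σ n (λ j → f i j)) ≡ Σ n (λ j → Σ n (λ i → f i j))
    Σ-comm f = trans (Σ-cong λ i → Σ≡sum n (f i)) (trans (Σ≡sum n _) (trans (∑-comm f)
      (sym (trans (Σ-cong λ j → Σ≡sum n (λ i → f i j)) (Σ≡sum n _)))))

    Σ-δʳ : (i : Fin n) (f : Fin n → ℕ) → Σ n (λ j → f j * δ i j) ≡ f i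
    Σ-δʳ i f = trans (Σ-cong λ j → *-comm (f j) (δ i j)) (Σ-δ i f)

    Σ² : Mat n → ℕ
    Σ² F = Σ n λ i → Σ n λ j → F i j

    Σ³ : (Fin n → Fin n → Fin n → ℕ) → ℕ
    Σ³ F = Σ n λ i → Σ² (F i)

    Σ⁴ : (Fin n → Fin n → Fin n → Fin n → ℕ) → ℕ
    Σ⁴ F = Σ n λ i → Σ³ (F i)

    Σ²-cong : {F G : Mat n} → (∀ i j → F i j ≡ G i j) → Σ² F ≡ Σ² G
    Σ²-cong F≗G = Σ-cong λ i → Σ-cong (F≗G i)

    Σ³-cong : {F G : Fin n → Fin n → Fin n → ℕ} → (∀ i j k → F i j k ≡ G i j k) → Σ³ F ≡ Σ³ G
    Σ³-cong F≗G = Σ-cong λ i → Σ²-cong (F≗G i)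

    Σ⁴-cong : {F G : Fin n → Fin n → Fin n → Fin n → ℕ} →
              (∀ i j k l → F i j k l ≡ G i j k l) → Σ⁴ F ≡ Σ⁴ G
    Σ⁴-cong F≗G = Σ-cong λ i → Σ³-cong (F≗G i)

    Σ²-+ : (F G : Mat n) → Σ² (λ i j → F i j + G i j) ≡ Σ² F + Σ² G
    Σ²-+ F G = trans (Σ-cong λ i → Σ-+ (F i) (G i)) (Σ-+ _ _)

    Σ³-+ : (F G : Fin n → Fin n → Fin n → ℕ) → Σ³ (λ i j k → F i j k + G i j k) ≡ Σ³ F + Σ³ G
    Σ³-+ F G = trans (Σ-cong λ i → Σ²-+ (F i) (G i)) (Σ-+ _ _)

    Σ⁴-+ : (F G : Fin n → Fin n → Fin n → Fin n → ℕ) →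
           Σ⁴ (λ i j k l → F i j k l + G i j k l) ≡ Σ⁴ F + Σ⁴ G
    Σ⁴-+ F G = trans (Σ-cong λ i → Σ³-+ (F i) (G i)) (Σ-+ _ _)

    Σ³-+₃ : (F G H : Fin n → Fin n → Fin n → ℕ) →
            Σ³ (λ i j k → F i j k + G i j k + H i j k) ≡ Σ³ F + Σ³ G + Σ³ H
    Σ³-+₃ F G H = trans (Σ³-+ _ H) (cong (_+ Σ³ H) (Σ³-+ F G))

    Σ⁴-+₃ : (F G H : Fin n → Fin n → Fin n → Fin n → ℕ) →
            Σ⁴ (λ i j k l → F i j k l + G i j k l + H i j k l) ≡ Σ⁴ F + Σ⁴ G + Σ⁴ H
    Σ⁴-+₃ F G H = trans (Σ⁴-+ _ H) (cong (_+ Σ⁴ H) (Σ⁴-+ F G))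

    Σ⁴-+₄ : (F G H K : Fin n → Fin n → Fin n → Fin n → ℕ) →
            Σ⁴ (λ i j k l → F i j k l + G i j k l + H i j k l + K i j k l) ≡ Σ⁴ F + Σ⁴ G + Σ⁴ H + Σ⁴ K
    Σ⁴-+₄ F G H K = trans (Σ⁴-+ _ K) (cong (_+ Σ⁴ K) (Σ⁴-+₃ F G H))

    Σ²-*ˡ : (c : ℕ) (F : Mat n) → Σ² (λ i j → c * F i j) ≡ c * Σ² F
    Σ²-*ˡ c F = trans (Σ-cong λ i → Σ-*ˡ c (F i)) (Σ-*ˡ c _)

    Σ³-*ˡ : (c : ℕ) (F : Fin n → Fin n → Fin n → ℕ) → Σ³ (λ i j k → c * F i j k) ≡ c * Σ³ F
    Σ³-*ˡ c F = trans (Σ-cong λ i → Σ²-*ˡ c (F i)) (Σ-*ˡ c _)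

    Σ⁴-*ˡ : (c : ℕ) (F : Fin n → Fin n → Fin n → Fin n → ℕ) →
            Σ⁴ (λ i j k l → c * F i j k l) ≡ c * Σ⁴ F
    Σ⁴-*ˡ c F = trans (Σ-cong λ i → Σ³-*ˡ c (F i)) (Σ-*ˡ c _)

    Σ⁴-zero : Σ⁴ (λ _ _ _ _ → 0) ≡ 0
    Σ⁴-zero = trans (Σ-cong λ _ → trans (Σ-cong λ _ → trans (Σ-cong λ _ → Σ-zero n) (Σ-zero n))
                                        (Σ-zero n))
                    (Σ-zero n)

    Σ⁴-sum : (Fs : List (Fin n → Fin n → Fin n → Fin n → ℕ)) →
      Σ⁴ (λ v w x y → List.sum (map (λ F → F v w x y) Fs)) ≡ List.sum (map Σ⁴ Fs)
    Σ⁴-sum []       = Σ⁴-zero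
    Σ⁴-sum (F ∷ Fs) = trans (Σ⁴-+ F _) (cong (Σ⁴ F +_) (Σ⁴-sum Fs))

    Σ²-swap : (F : Mat n) → Σ² F ≡ Σ² (λ i j → F j i)
    Σ²-swap = Σ-comm

    Σ³-swap₁₂ : (F : Fin n → Fin n → Fin n → ℕ) → Σ³ F ≡ Σ³ (λ i j k → F j i k)
    Σ³-swap₁₂ F = Σ-comm λ i j → Σ n (F i j)

    Σ³-rotate : (F : Fin n → Fin n → Fin n → ℕ) → Σ³ F ≡ Σ³ (λ i j k → F j k i)
    Σ³-rotate F = trans (Σ-cong λ i → Σ²-swap (F i)) (Σ³-swap₁₂ λ i j k → F i k j)

    Σ⁴-swap₁₂ : (F : Fin n → Fin n → Fin n → Fin n → ℕ) → Σ⁴ F ≡ Σ⁴ (λ i j k l → F j i k l)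
    Σ⁴-swap₁₂ F = Σ-comm λ i j → Σ² (F i j)

    Σ⁴-rotate₃ : (F : Fin n → Fin n → Fin n → Fin n → ℕ) → Σ⁴ F ≡ Σ⁴ (λ i j k l → F j k i l)
    Σ⁴-rotate₃ F = Σ³-rotate λ i j k → Σ n (F i j k)

    Σ⁴-rotate : (F : Fin n → Fin n → Fin n → Fin n → ℕ) → Σ⁴ F ≡ Σ⁴ (λ i j k l → F j k l i)
    Σ⁴-rotate F = trans (Σ-cong λ i → Σ³-rotate (F i)) (Σ⁴-swap₁₂ λ i j k l → F i k l j)

    -- Symₖ F sums F over the k! orderings of its arguments: insertₖ F i places the first
    -- argument i at each position among the others, whose orderings are then summed.

    Sym₂ : Mat n → Mat n
    Sym₂ F i j = F i j + F j i

    insert₃ : (Fin n → Fin n → Fin n → ℕ) → Fin n → Fin n → Fin n → ℕ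
    insert₃ F i j k = F i j k + F j i k + F j k i

    Sym₃ : (Fin n → Fin n → Fin n → ℕ) → Fin n → Fin n → Fin n → ℕ
    Sym₃ F i = Sym₂ (insert₃ F i)

    insert₄ : (Fin n → Fin n → Fin n → Fin n → ℕ) → Fin n → Fin n → Fin n → Fin n → ℕ
    insert₄ F i j k l = F i j k l + F j i k l + F j k i l + F j k l i

    Sym₄ : (Fin n → Fin n → Fin n → Fin n → ℕ) → Fin n → Fin n → Fin n → Fin n → ℕ
    Sym₄ F i = Sym₃ (insert₄ F i)

    Sym₂-scale : (a : Fin n → ℕ) (F : Mat n) (j k : Fin n) →
      Sym₂ (λ j k → a j * a k * F j k) j k ≡ a j * a k * Sym₂ F j k
    Sym₂-scale a F j k with a j | a k | F j k | F k j
    ... | x | y | p | q = solve (x ∷ y ∷ p ∷ q ∷ [])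

    Sym₃-scale : (a : Fin n → ℕ) (F : Fin n → Fin n → Fin n → ℕ) (j k l : Fin n) →
      Sym₃ (λ j k l → a j * a k * a l * F j k l) j k l ≡ a j * a k * a l * Sym₃ F j k l
    Sym₃-scale a F j k l with a j | a k | a l
    ... | x | y | z with F j k l | F k j l | F k l j | F j l k | F l j k | F l k j
    ... | p₁ | p₂ | p₃ | p₄ | p₅ | p₆ =
      solve (x ∷ y ∷ z ∷ p₁ ∷ p₂ ∷ p₃ ∷ p₄ ∷ p₅ ∷ p₆ ∷ [])

    private
      regroup₃ : ∀ x y a b c → x * y * a + x * y * b + x * y * c ≡ y * (x * (a + b + c))
      regroup₃ = solve-∀

      regroup₄ : ∀ x y a b c d → x * y * a + x * y * b + x * y * c + x * y * d ≡ y * (x * (a + b + c + d))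
      regroup₄ = solve-∀

      merge-weights : ∀ x y {c} s → x * y ≡ c → y * (x * s) ≡ c * s
      merge-weights x y s xy≡c = trans (x∙yz≈y∙xz y x s) (trans (sym (*-assoc x y s)) (cong (_* s) xy≡c))

    sort₂ : (F : Mat n) → Σ² (λ i j → ne i j * F i j) ≡ Σ² (λ i j → lt i j * Sym₂ F i j)
    sort₂ F = begin
      Σ² (λ i j → ne i j * F i j)
        ≡⟨ Σ²-cong (λ i j → *-distribʳ-+ (F i j) (lt i j) (lt j i)) ⟩
      Σ² (λ i j → lt i j * F i j + lt j i * F i j)
        ≡⟨ Σ²-+ _ _ ⟩
      Σ² (λ i j → lt i j * F i j) + Σ² (λ i j → lt j i * F i j)
        ≡⟨ cong (Σ² (λ i j → lt i j * F i j) +_) (Σ²-swap _) ⟩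
      Σ² (λ i j → lt i j * F i j) + Σ² (λ i j → lt i j * F j i)
        ≡⟨ Σ²-+ _ _ ⟨
      Σ² (λ i j → lt i j * F i j + lt i j * F j i)
        ≡⟨ Σ²-cong (λ i j → *-distribˡ-+ (lt i j) (F i j) (F j i)) ⟨
      Σ² (λ i j → lt i j * Sym₂ F i j) ∎

    sort₃ : (F : Fin n → Fin n → Fin n → ℕ) →
      Σ³ (λ i j k → distinct₃ i j k * F i j k) ≡ Σ³ (λ i j k → lt i j * lt j k * Sym₃ F i j k)
    sort₃ F = begin
      Σ³ (λ i j k → distinct₃ i j k * F i j k)
        ≡⟨ Σ³-cong (λ i j k → trans (cong (_* F i j k) (distinct₃-by-least i j k))
                                    (*-distrib₃ (least₃ i j k) (least₃ j i k) (least₃ k i j) (F i j k))) ⟩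
      Σ³ (λ i j k → least₃ i j k * F i j k + least₃ j i k * F i j k + least₃ k i j * F i j k)
        ≡⟨ Σ³-+₃ _ _ _ ⟩
      Σ³ (λ i j k → least₃ i j k * F i j k) + Σ³ (λ i j k → least₃ j i k * F i j k)
        + Σ³ (λ i j k → least₃ k i j * F i j k)
        ≡⟨ cong₂ (λ a b → Σ³ (λ i j k → least₃ i j k * F i j k) + a + b)
                 (Σ³-swap₁₂ _) (Σ³-rotate _) ⟩
      Σ³ (λ i j k → least₃ i j k * F i j k) + Σ³ (λ i j k → least₃ i j k * F j i k)
        + Σ³ (λ i j k → least₃ i j k * F j k i)
        ≡⟨ Σ³-+₃ _ _ _ ⟨
      Σ³ (λ i j k → least₃ i j k * F i j k + least₃ i j k * F j i k + least₃ i j k * F j k i)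
        ≡⟨ Σ³-cong (λ i j k → regroup₃ (lt i j * lt i k) (ne j k) (F i j k) (F j i k) (F j k i)) ⟩
      Σ n (λ i → Σ² (λ j k → ne j k * (lt i j * lt i k * insert₃ F i j k)))
        ≡⟨ Σ-cong (λ i → sort₂ _) ⟩
      Σ n (λ i → Σ² (λ j k → lt j k * Sym₂ (λ j k → lt i j * lt i k * insert₃ F i j k) j k))
        ≡⟨ Σ³-cong (λ i j k → trans (cong (lt j k *_) (Sym₂-scale (lt i) (insert₃ F i) j k))
                                    (merge-weights (lt i j * lt i k) (lt j k) (Sym₃ F i j k) (lt-chain₃ i j k))) ⟩
      Σ³ (λ i j k → lt i j * lt j k * Sym₃ F i j k) ∎
      where
      *-distrib₃ : ∀ a b c x → (a + b + c) * x ≡ a * x + b * x + c * x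
      *-distrib₃ = solve-∀

    sort₄ : (F : Fin n → Fin n → Fin n → Fin n → ℕ) →
      Σ⁴ (λ i j k l → distinct₄ i j k l * F i j k l) ≡
      Σ⁴ (λ i j k l → lt i j * lt j k * lt k l * Sym₄ F i j k l)
    sort₄ F = begin
      Σ⁴ (λ i j k l → distinct₄ i j k l * F i j k l)
        ≡⟨ Σ⁴-cong (λ i j k l → trans (cong (_* F i j k l) (distinct₄-by-least i j k l))
             (*-distrib₄ (least₄ i j k l) (least₄ j i k l) (least₄ k i j l) (least₄ l i j k) (F i j k l))) ⟩
      Σ⁴ (λ i j k l → least₄ i j k l * F i j k l + least₄ j i k l * F i j k l
                    + least₄ k i j l * F i j k l + least₄ l i j k * F i j k l)
        ≡⟨ Σ⁴-+₄ _ _ _ _ ⟩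
      Σ⁴ (λ i j k l → least₄ i j k l * F i j k l) + Σ⁴ (λ i j k l → least₄ j i k l * F i j k l)
        + Σ⁴ (λ i j k l → least₄ k i j l * F i j k l) + Σ⁴ (λ i j k l → least₄ l i j k * F i j k l)
        ≡⟨ cong₂ _+_ (cong₂ _+_ (cong (Σ⁴ (λ i j k l → least₄ i j k l * F i j k l) +_) (Σ⁴-swap₁₂ _))
                                (Σ⁴-rotate₃ _))
                     (Σ⁴-rotate _) ⟩
      Σ⁴ (λ i j k l → least₄ i j k l * F i j k l) + Σ⁴ (λ i j k l → least₄ i j k l * F j i k l)
        + Σ⁴ (λ i j k l → least₄ i j k l * F j k i l) + Σ⁴ (λ i j k l → least₄ i j k l * F j k l i)
        ≡⟨ Σ⁴-+₄ _ _ _ _ ⟨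
      Σ⁴ (λ i j k l → least₄ i j k l * F i j k l + least₄ i j k l * F j i k l
                    + least₄ i j k l * F j k i l + least₄ i j k l * F j k l i)
        ≡⟨ Σ⁴-cong (λ i j k l → regroup₄ (lt i j * lt i k * lt i l) (distinct₃ j k l)
                                          (F i j k l) (F j i k l) (F j k i l) (F j k l i)) ⟩
      Σ n (λ i → Σ³ (λ j k l → distinct₃ j k l * (lt i j * lt i k * lt i l * insert₄ F i j k l)))
        ≡⟨ Σ-cong (λ i → sort₃ _) ⟩
      Σ n (λ i → Σ³ (λ j k l → lt j k * lt k l *
                       Sym₃ (λ j k l → lt i j * lt i k * lt i l * insert₄ F i j k l) j k l))
        ≡⟨ Σ⁴-cong (λ i j k l → trans (cong (lt j k * lt k l *_) (Sym₃-scale (lt i) (insert₄ F i) j k l))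
                                      (merge-weights (lt i j * lt i k * lt i l) (lt j k * lt k l) (Sym₄ F i j k l)
                                                     (lt-chain₄ i j k l))) ⟩
      Σ⁴ (λ i j k l → lt i j * lt j k * lt k l * Sym₄ F i j k l) ∎
      where
      *-distrib₄ : ∀ a b c d x → (a + b + c + d) * x ≡ a * x + b * x + c * x + d * x
      *-distrib₄ = solve-∀

    *-ne : (u v : Fin n) (x : ℕ) → (u ≡ v → x ≡ 0) → x * ne u v ≡ x
    *-ne u v x vanishes with u ≟ v | δ+ne≡1 u v
    ... | yes refl | _    rewrite vanishes refl = refl
    ... | no _     | ne≡1 = trans (cong (x *_) ne≡1) (*-identityʳ x)

    _⊞_ : Mat n → Mat n → Mat n
    (X ⊞ Y) u v = X u v + Y u v

    diag : (Fin n → ℕ) → Mat n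
    diag s u v = δ u v * s v

    _▷_ : Mat n → (Fin n → ℕ) → Mat n
    (X ▷ s) u v = X u v * s v

    tr₁ : Mat n → ℕ
    tr₁ X = Σ n λ v → X v v

    tr₂ : Mat n → Mat n → ℕ
    tr₂ X Y = Σ² λ v w → X v w * Y w v

    tr₃ : Mat n → Mat n → Mat n → ℕ
    tr₃ X Y Z = Σ³ λ v w x → X v w * Y w x * Z x v

    cycle₄ : Mat n → Mat n → Mat n → Mat n → Fin n → Fin n → Fin n → Fin n → ℕ
    cycle₄ X Y Z U v w x y = X v w * Y w x * Z x y * U y v

    tr₄ : Mat n → Mat n → Mat n → Mat n → ℕ
    tr₄ X Y Z U = Σ⁴ (cycle₄ X Y Z U)

    tr₁-cong : {X X′ : Mat n} → (∀ u v → X u v ≡ X′ u v) → tr₁ X ≡ tr₁ X′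
    tr₁-cong X≗X′ = Σ-cong λ v → X≗X′ v v

    tr₂-cong₂ : (X : Mat n) {Y Y′ : Mat n} → (∀ u v → Y u v ≡ Y′ u v) → tr₂ X Y ≡ tr₂ X Y′
    tr₂-cong₂ X Y≗Y′ = Σ²-cong λ v w → cong (X v w *_) (Y≗Y′ w v)

    tr₃-cong₃ : (X Y : Mat n) {Z Z′ : Mat n} → (∀ u v → Z u v ≡ Z′ u v) → tr₃ X Y Z ≡ tr₃ X Y Z′
    tr₃-cong₃ X Y Z≗Z′ = Σ³-cong λ v w x → cong (X v w * Y w x *_) (Z≗Z′ x v)

    tr₄-cong : {M N : Mat n} → (∀ u v → M u v ≡ N u v) → tr₄ M M M M ≡ tr₄ N N N N
    tr₄-cong M≗N = Σ⁴-cong λ v w x y →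
      cong₂ _*_ (cong₂ _*_ (cong₂ _*_ (M≗N v w) (M≗N w x)) (M≗N x y)) (M≗N y v)

    tr₃-rotate : (X Y Z : Mat n) → tr₃ X Y Z ≡ tr₃ Y Z X
    tr₃-rotate X Y Z = trans (sym (Σ³-rotate λ v w x → X x v * Y v w * Z w x))
                             (Σ³-cong λ v w x → rotate (X x v) (Y v w) (Z w x))
      where
      rotate : ∀ a b c → a * b * c ≡ b * c * a
      rotate = solve-∀

    tr₄-rotate : (X Y Z U : Mat n) → tr₄ X Y Z U ≡ tr₄ Y Z U X
    tr₄-rotate X Y Z U = trans (sym (Σ⁴-rotate λ v w x y → X y v * Y v w * Z w x * U x y))
                               (Σ⁴-cong λ v w x y → rotate (X y v) (Y v w) (Z w x) (U x y))
      where
      rotate : ∀ a b c d → a * b * c * d ≡ b * c * d * a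
      rotate = solve-∀

    tr₄-multilinear : (X Y : Mat n) →
      tr₄ (X ⊞ Y) (X ⊞ Y) (X ⊞ Y) (X ⊞ Y) ≡ List.sum (map (uncurry₄ tr₄) (quadruples X Y))
    tr₄-multilinear X Y = trans (Σ⁴-cong expand) (Σ⁴-sum (map (uncurry₄ cycle₄) (quadruples X Y)))
      where
      expand : ∀ v w x y → cycle₄ (X ⊞ Y) (X ⊞ Y) (X ⊞ Y) (X ⊞ Y) v w x y ≡
               List.sum (map (λ F → F v w x y) (map (uncurry₄ cycle₄) (quadruples X Y)))
      expand v w x y with X v w | Y v w | X w x | Y w x | X x y | Y x y | X y v | Y y v
      ... | a | a′ | b | b′ | c | c′ | d | d′ =
        solve (a ∷ a′ ∷ b ∷ b′ ∷ c ∷ c′ ∷ d ∷ d′ ∷ [])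

    tr₄-binomial : (X Y : Mat n) → tr₄ (X ⊞ Y) (X ⊞ Y) (X ⊞ Y) (X ⊞ Y) ≡
      tr₄ X X X X + 4 * tr₄ Y X X X + 4 * tr₄ Y Y X X + 2 * tr₄ Y X Y X + 4 * tr₄ Y Y Y X + tr₄ Y Y Y Y
    tr₄-binomial X Y = trans (tr₄-multilinear X Y) (cyclic-binomial tr₄ tr₄-rotate X Y)

    Σ-diag : (s f : Fin n → ℕ) (v : Fin n) → Σ n (λ y → f y * diag s y v) ≡ f v * s v
    Σ-diag s f v = trans (Σ-cong λ y → trans (cong (λ d → f y * (d * s v)) (δ-sym y v))
                                             (x∙yz≈y∙xz (f y) (δ v y) (s v)))
                         (Σ-δ v λ y → f y * s v)

    tr₄-diag : (X Y Z : Mat n) (s : Fin n → ℕ) → tr₄ X Y Z (diag s) ≡ tr₃ X Y (Z ▷ s)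
    tr₄-diag X Y Z s = Σ³-cong λ v w x →
      trans (Σ-diag s (λ y → X v w * Y w x * Z x y) v) (*-assoc (X v w * Y w x) (Z x v) (s v))

    tr₃-diag : (X Y : Mat n) (s : Fin n → ℕ) → tr₃ X Y (diag s) ≡ tr₂ X (Y ▷ s)
    tr₃-diag X Y s = Σ²-cong λ v w →
      trans (Σ-diag s (λ x → X v w * Y w x) v) (*-assoc (X v w) (Y w v) (s v))

    tr₂-diag : (X : Mat n) (s : Fin n → ℕ) → tr₂ X (diag s) ≡ tr₁ (X ▷ s)
    tr₂-diag X s = Σ-cong λ v → Σ-diag s (X v) v

    diag-▷ : (s : Fin n → ℕ) → (∀ v → s v * s v ≡ s v) → ∀ u v → (diag s ▷ s) u v ≡ diag s u v
    diag-▷ s s-idem u v = trans (*-assoc (δ u v) (s v) (s v)) (cong (δ u v *_) (s-idem v))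

    closed-walks-as-trace : (M : Mat n) (v : Fin n) →
      Σ n (λ w → M v w * Σ n (λ x → M w x * Σ n (λ y → M x y * Σ n (λ z → M y z * ι ⌊ z ≟ v ⌋))))
      ≡ Σ³ (λ w x y → M v w * M w x * M x y * M y v)
    closed-walks-as-trace M v = begin
      Σ n (λ w → M v w * Σ n (λ x → M w x * Σ n (λ y → M x y * Σ n (λ z → M y z * ι ⌊ z ≟ v ⌋))))
        ≡⟨ Σ-cong (λ w → cong (M v w *_) (Σ-cong λ x → cong (M w x *_) (Σ-cong λ y →
             cong (M x y *_) (trans (Σ-cong λ z → cong (M y z *_) (trans (ι-≟ z v) (δ-sym z v)))
                                    (Σ-δʳ v (M y)))))) ⟩
      Σ n (λ w → M v w * Σ n (λ x → M w x * Σ n (λ y → M x y * M y v)))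
        ≡⟨ Σ-cong (λ w → cong (M v w *_) (Σ-cong λ x → Σ-*ˡ (M w x) _)) ⟨
      Σ n (λ w → M v w * Σ² (λ x y → M w x * (M x y * M y v)))
        ≡⟨ Σ-cong (λ w → Σ²-*ˡ (M v w) _) ⟨
      Σ³ (λ w x y → M v w * (M w x * (M x y * M y v)))
        ≡⟨ Σ³-cong (λ w x y → reassoc (M v w) (M w x) (M x y) (M y v)) ⟩
      Σ³ (λ w x y → M v w * M w x * M x y * M y v) ∎
      where
      reassoc : ∀ a b c d → a * (b * (c * d)) ≡ a * b * c * d
      reassoc = solve-∀

    module _ (G : Graph n) where

      private
        E : Mat n
        E = e G

      e-sym : ∀ u v → E u v ≡ E v u
      e-sym u v = cong ι (adj-sym G u v)

      e-irr : ∀ v → E v v ≡ 0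
      e-irr v = cong ι (irr G v)

      e-ne : ∀ u v → E u v * ne u v ≡ E u v
      e-ne u v = *-ne u v (E u v) λ { refl → e-irr u }

      handshake : Σ n (deg G) ≡ 2 * size G
      handshake = begin
        Σ² E                                    ≡⟨ Σ²-cong (λ u v → trans (sym (e-ne u v))
                                                                          (*-comm _ (ne u v))) ⟩
        Σ² (λ u v → ne u v * E u v)             ≡⟨ sort₂ E ⟩
        Σ² (λ u v → lt u v * Sym₂ E u v)        ≡⟨ Σ²-cong twice ⟩
        Σ² (λ u v → 2 * (ι (u <ᵇ v) * E u v))   ≡⟨ Σ²-*ˡ 2 _ ⟩
        2 * size G                              ∎
        where
        twice : ∀ u v → lt u v * Sym₂ E u v ≡ 2 * (ι (u <ᵇ v) * E u v)
        twice u v rewrite e-sym v u | ι-<ᵇ u v with lt u v | E u v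
        ... | a | b = solve (a ∷ b ∷ [])

      degree-square : Σ³ (λ v w y → E v w * E v y) ≡ M1 G
      degree-square = Σ-cong λ v → trans (Σ-cong λ w → Σ-*ˡ (E v w) (E v)) (Σ-*ʳ (deg G v) (E v))

      cyc-δ₁₃ : Σ⁴ (λ v w x y → cyc G v w x y * δ v x) ≡ M1 G
      cyc-δ₁₃ = trans (Σ-cong λ v → Σ-cong λ w →
                         trans (Σ-cong λ x → Σ-*ʳ (δ v x) (cyc G v w x)) (Σ-δʳ v λ x → Σ n (cyc G v w x)))
                      (trans (Σ³-cong back-and-forth) degree-square)
        where
        back-and-forth : ∀ v w y → cyc G v w v y ≡ E v w * E v y
        back-and-forth v w y rewrite adj-sym G w v | adj-sym G y v with adj G v w | adj G v y
        ... | true  | true  = refl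
        ... | true  | false = refl
        ... | false | _     = refl

      cyc-δ₂₄ : Σ⁴ (λ v w x y → cyc G v w x y * δ w y) ≡ M1 G
      cyc-δ₂₄ = trans (Σ³-cong λ v w x → Σ-δʳ w (cyc G v w x))
                      (trans (Σ³-cong back-and-forth) (trans (sym (Σ³-swap₁₂ _)) degree-square))
        where
        back-and-forth : ∀ v w x → cyc G v w x w ≡ E w v * E w x
        back-and-forth v w x rewrite adj-sym G v w | adj-sym G x w with adj G w v | adj G w x
        ... | true  | true  = refl
        ... | true  | false = refl
        ... | false | _     = refl

      cyc-δ₁₃-δ₂₄ : Σ⁴ (λ v w x y → cyc G v w x y * δ v x * δ w y) ≡ Σ n (deg G)
      cyc-δ₁₃-δ₂₄ = trans (Σ³-cong λ v w x → Σ-δʳ w (λ y → cyc G v w x y * δ v x))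
                          (Σ²-cong λ v w → trans (Σ-δʳ v (λ x → cyc G v w x w)) (back-and-forth v w))
        where
        back-and-forth : ∀ v w → cyc G v w v w ≡ E v w
        back-and-forth v w rewrite adj-sym G w v with adj G v w
        ... | true  = refl
        ... | false = refl

      cycles : Fin n → Fin n → Fin n → Fin n → ℕ
      cycles i j k l = cyc G i j k l + cyc G i j l k + cyc G i k j l

      cyc-distinct : ∀ v w x y → cyc G v w x y * ne v x * ne w y ≡ distinct₄ v w x y * cyc G v w x y
      cyc-distinct v w x y = begin
        cyc G v w x y * ne v x * ne w y
          ≡⟨ cong (λ c → c * ne v x * ne w y) (*-absorb₄ (e-ne v w) (e-ne w x) (e-ne x y) (e-ne y v)) ⟩
        ne v w * ne w x * ne x y * ne y v * cyc G v w x y * ne v x * ne w y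
          ≡⟨ cong (λ m → ne v w * ne w x * ne x y * m * cyc G v w x y * ne v x * ne w y)
                  (+-comm (lt y v) (lt v y)) ⟩
        ne v w * ne w x * ne x y * ne v y * cyc G v w x y * ne v x * ne w y
          ≡⟨ shuffle (ne v w) (ne w x) (ne x y) (ne v y) (cyc G v w x y) (ne v x) (ne w y) ⟩
        distinct₄ v w x y * cyc G v w x y ∎
        where
        shuffle : ∀ a b c d z p q → a * b * c * d * z * p * q ≡ a * p * d * (b * q * c) * z
        shuffle = solve-∀

      Sym₄-cyc : ∀ i j k l → Sym₄ (cyc G) i j k l ≡ 8 * cycles i j k l
      Sym₄-cyc i j k l
        rewrite adj-sym G j i | adj-sym G k i | adj-sym G l i | adj-sym G k j | adj-sym G l j | adj-sym G l k
        with E i j | E i k | E i l | E j k | E j l | E k l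
      ... | a | b | c | d | f | g = solve (a ∷ b ∷ c ∷ d ∷ f ∷ g ∷ [])

      K4 : Fin n → Fin n → Fin n → Fin n → Bool
      K4 i j k l = adj G i j ∧ adj G i k ∧ adj G i l ∧ adj G j k ∧ adj G j l ∧ adj G k l

      K4-edges : Fin n → Fin n → Fin n → Fin n → ℕ
      K4-edges i j k l = E i j * E i k * E i l * E j k * E j l * E k l

      cycles-K4 : ∀ i j k l → ι (not (K4 i j k l)) * cycles i j k l + 3 * K4-edges i j k l ≡ cycles i j k l
      cycles-K4 i j k l rewrite adj-sym G l i | adj-sym G l k | adj-sym G k i | adj-sym G k j =
        K4-split (adj G i j) (adj G i k) (adj G i l) (adj G j k) (adj G j l) (adj G k l)

      sorted₄ : Fin n → Fin n → Fin n → Fin n → ℕ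
      sorted₄ i j k l = ι (i <ᵇ j) * ι (j <ᵇ k) * ι (k <ᵇ l)

      four-cycles : ℕ
      four-cycles = nC4 G + 3 * nK4 G

      count-4-cycles : Σ⁴ (λ i j k l → lt i j * lt j k * lt k l * cycles i j k l) ≡ four-cycles
      count-4-cycles = sym (begin
        nC4 G + 3 * nK4 G
          ≡⟨ cong (nC4 G +_) (Σ⁴-*ˡ 3 _) ⟨
        nC4 G + Σ⁴ (λ i j k l → 3 * (sorted₄ i j k l * K4-edges i j k l))
          ≡⟨ Σ⁴-+ _ _ ⟨
        Σ⁴ (λ i j k l → sorted₄ i j k l * (ι (not (K4 i j k l)) * cycles i j k l)
                      + 3 * (sorted₄ i j k l * K4-edges i j k l))
          ≡⟨ Σ⁴-cong pointwise ⟩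
        Σ⁴ (λ i j k l → lt i j * lt j k * lt k l * cycles i j k l) ∎)
        where
        factor : ∀ c p x y → c * (p * x) + 3 * (c * y) ≡ c * (p * x + 3 * y)
        factor = solve-∀
        pointwise : ∀ i j k l →
          sorted₄ i j k l * (ι (not (K4 i j k l)) * cycles i j k l) + 3 * (sorted₄ i j k l * K4-edges i j k l)
          ≡ lt i j * lt j k * lt k l * cycles i j k l
        pointwise i j k l rewrite ι-<ᵇ i j | ι-<ᵇ j k | ι-<ᵇ k l =
          trans (factor (lt i j * lt j k * lt k l) (ι (not (K4 i j k l))) (cycles i j k l) (K4-edges i j k l))
                (cong (lt i j * lt j k * lt k l *_) (cycles-K4 i j k l))

      distinct-cycles : Σ⁴ (λ v w x y → cyc G v w x y * ne v x * ne w y) ≡ 8 * four-cycles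
      distinct-cycles = begin
        Σ⁴ (λ v w x y → cyc G v w x y * ne v x * ne w y)                     ≡⟨ Σ⁴-cong cyc-distinct ⟩
        Σ⁴ (λ v w x y → distinct₄ v w x y * cyc G v w x y)                   ≡⟨ sort₄ (cyc G) ⟩
        Σ⁴ (λ i j k l → lt i j * lt j k * lt k l * Sym₄ (cyc G) i j k l)
          ≡⟨ Σ⁴-cong (λ i j k l → trans (cong (lt i j * lt j k * lt k l *_) (Sym₄-cyc i j k l))
                                        (x∙yz≈y∙xz (lt i j * lt j k * lt k l) 8 _)) ⟩
        Σ⁴ (λ i j k l → 8 * (lt i j * lt j k * lt k l * cycles i j k l))     ≡⟨ Σ⁴-*ˡ 8 _ ⟩
        8 * Σ⁴ (λ i j k l → lt i j * lt j k * lt k l * cycles i j k l)       ≡⟨ cong (8 *_) count-4-cycles ⟩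
        8 * four-cycles                                                      ∎

      loopless-closed-walks : tr₄ E E E E + 2 * size G ≡ 2 * M1 G + 8 * four-cycles
      loopless-closed-walks = begin
        Σ⁴ (cyc G) + 2 * size G
          ≡⟨ cong (Σ⁴ (cyc G) +_) (trans (sym handshake) (sym cyc-δ₁₃-δ₂₄)) ⟩
        Σ⁴ (cyc G) + Σ⁴ (λ v w x y → cyc G v w x y * δ v x * δ w y)
          ≡⟨ Σ⁴-+ _ _ ⟨
        Σ⁴ (λ v w x y → cyc G v w x y + cyc G v w x y * δ v x * δ w y)
          ≡⟨ Σ⁴-cong (λ v w x y → inclusion-exclusion (cyc G v w x y) (δ+ne≡1 v x) (δ+ne≡1 w y)) ⟩
        Σ⁴ (λ v w x y → cyc G v w x y * δ v x + cyc G v w x y * δ w y + cyc G v w x y * ne v x * ne w y)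
          ≡⟨ Σ⁴-+₃ _ _ _ ⟩
        Σ⁴ (λ v w x y → cyc G v w x y * δ v x) + Σ⁴ (λ v w x y → cyc G v w x y * δ w y)
          + Σ⁴ (λ v w x y → cyc G v w x y * ne v x * ne w y)
          ≡⟨ cong₂ _+_ (cong₂ _+_ cyc-δ₁₃ cyc-δ₂₄) distinct-cycles ⟩
        M1 G + M1 G + 8 * four-cycles
          ≡⟨ cong (λ m → M1 G + m + 8 * four-cycles) (+-identityʳ (M1 G)) ⟨
        2 * M1 G + 8 * four-cycles ∎

      module _ (S : Subset n) where

        private
          s : Fin n → ℕ
          s v = ι (inS S v)

          L : Mat n
          L = diag s

          s-idem : ∀ v → s v * s v ≡ s v
          s-idem v = ι-idem (inS S v)

        weighted-triangles : ℕ
        weighted-triangles = nTri G S 1 + 2 * nTri G S 2 + 3 * nTri G S 3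

        S-edges : ℕ
        S-edges = tr₂ (E ▷ s) (E ▷ s)

        triangle : Fin n → Fin n → Fin n → ℕ
        triangle i j k = E i j * E j k * E i k

        triangle-support : ∀ v w x →
          E v w * E w x * (E x v * s v) ≡ distinct₃ v w x * (E v w * E w x * (E x v * s v))
        triangle-support v w x =
          trans (*-absorb₃ (e-ne v w) (e-ne w x) (*-ne x v _ λ { refl → cong (_* s x) (e-irr x) }))
                (cong (_* (E v w * E w x * (E x v * s v))) reorder)
          where
          reorder : ne v w * ne w x * ne x v ≡ distinct₃ v w x
          reorder rewrite +-comm (lt x v) (lt v x) = xy∙z≈xz∙y (ne v w) (ne w x) (ne v x)

        Sym₃-triangle : ∀ i j k → Sym₃ (λ v w x → E v w * E w x * (E x v * s v)) i j k ≡
                                  2 * (triangle i j k * (s i + s j + s k))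
        Sym₃-triangle i j k rewrite adj-sym G j i | adj-sym G k i | adj-sym G k j
          with E i j | E i k | E j k | s i | s j | s k
        ... | a | b | c | x | y | z = solve (a ∷ b ∷ c ∷ x ∷ y ∷ z ∷ [])

        triangle-with : ℕ → Fin n → Fin n → Fin n → ℕ
        triangle-with r i j k = ι (i <ᵇ j) * ι (j <ᵇ k) * triangle i j k * ι ⌊ (s i + s j + s k) ℕ.≟ r ⌋

        count-triangles : Σ³ (λ i j k → lt i j * lt j k * (triangle i j k * (s i + s j + s k))) ≡
                          weighted-triangles
        count-triangles = sym (begin
          nTri G S 1 + 2 * nTri G S 2 + 3 * nTri G S 3
            ≡⟨ cong₂ (λ a b → nTri G S 1 + a + b) (Σ³-*ˡ 2 _) (Σ³-*ˡ 3 _) ⟨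
          Σ³ (triangle-with 1) + Σ³ (λ i j k → 2 * triangle-with 2 i j k)
            + Σ³ (λ i j k → 3 * triangle-with 3 i j k)
            ≡⟨ Σ³-+₃ _ _ _ ⟨
          Σ³ (λ i j k → triangle-with 1 i j k + 2 * triangle-with 2 i j k + 3 * triangle-with 3 i j k)
            ≡⟨ Σ³-cong pointwise ⟩
          Σ³ (λ i j k → lt i j * lt j k * (triangle i j k * (s i + s j + s k))) ∎)
          where
          factor : ∀ c t d₁ d₂ d₃ →
            c * t * d₁ + 2 * (c * t * d₂) + 3 * (c * t * d₃) ≡ c * (t * (d₁ + 2 * d₂ + 3 * d₃))
          factor = solve-∀
          pointwise : ∀ i j k →
            triangle-with 1 i j k + 2 * triangle-with 2 i j k + 3 * triangle-with 3 i j k ≡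
            lt i j * lt j k * (triangle i j k * (s i + s j + s k))
          pointwise i j k =
            trans (factor (ι (i <ᵇ j) * ι (j <ᵇ k)) (triangle i j k) _ _ _)
                  (cong₂ _*_ (cong₂ _*_ (ι-<ᵇ i j) (ι-<ᵇ j k))
                             (cong (triangle i j k *_) (count-by-value (s i + s j + s k)
                               (+-mono-≤ (+-mono-≤ (ι-≤1 (inS S i)) (ι-≤1 (inS S j))) (ι-≤1 (inS S k))))))

        triangle-walks : tr₃ E E (E ▷ s) ≡ 2 * weighted-triangles
        triangle-walks = begin
          Σ³ (λ v w x → E v w * E w x * (E x v * s v))
            ≡⟨ Σ³-cong triangle-support ⟩
          Σ³ (λ v w x → distinct₃ v w x * (E v w * E w x * (E x v * s v)))
            ≡⟨ sort₃ _ ⟩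
          Σ³ (λ i j k → lt i j * lt j k * Sym₃ (λ v w x → E v w * E w x * (E x v * s v)) i j k)
            ≡⟨ Σ³-cong (λ i j k → trans (cong (lt i j * lt j k *_) (Sym₃-triangle i j k))
                                        (x∙yz≈y∙xz (lt i j * lt j k) 2 _)) ⟩
          Σ³ (λ i j k → 2 * (lt i j * lt j k * (triangle i j k * (s i + s j + s k))))
            ≡⟨ Σ³-*ˡ 2 _ ⟩
          2 * Σ³ (λ i j k → lt i j * lt j k * (triangle i j k * (s i + s j + s k)))
            ≡⟨ cong (2 *_) count-triangles ⟩
          2 * weighted-triangles ∎

        loop-step : ∀ u v → stepS G S u v ≡ (E ⊞ L) u v
        loop-step u v = cong (E u v +_) loop
          where
          loop : (if ⌊ u ≟ v ⌋ then s u else 0) ≡ δ u v * s v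
          loop with u ≟ v
          ... | yes refl = sym (+-identityʳ (s u))
          ... | no _     = refl

        one-loop : tr₄ L E E E ≡ tr₃ E E (E ▷ s)
        one-loop = trans (tr₄-rotate L E E E) (tr₄-diag E E E s)

        adjacent-loops : tr₄ L L E E ≡ sumDegS G S
        adjacent-loops = begin
          tr₄ L L E E        ≡⟨ trans (tr₄-rotate L L E E) (tr₄-rotate L E E L) ⟩
          tr₄ E E L L        ≡⟨ tr₄-diag E E L s ⟩
          tr₃ E E (L ▷ s)    ≡⟨ tr₃-cong₃ E E (diag-▷ s s-idem) ⟩
          tr₃ E E L          ≡⟨ tr₃-diag E E s ⟩
          tr₂ E (E ▷ s)      ≡⟨ Σ-cong (λ v → trans (Σ-cong λ w → there-and-back v w)
                                                     (Σ-*ˡ (s v) (E v))) ⟩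
          sumDegS G S        ∎
          where
          there-and-back : ∀ v w → E v w * (E w v * s v) ≡ s v * E v w
          there-and-back v w rewrite adj-sym G w v with adj G v w | inS S v
          ... | true  | true  = refl
          ... | true  | false = refl
          ... | false | b     = sym (*-zeroʳ (ι b))

        opposite-loops : tr₄ L E L E ≡ S-edges
        opposite-loops = begin
          tr₄ L E L E          ≡⟨ tr₄-rotate L E L E ⟩
          tr₄ E L E L          ≡⟨ tr₄-diag E L E s ⟩
          tr₃ E L (E ▷ s)      ≡⟨ trans (tr₃-rotate E L (E ▷ s)) (tr₃-rotate L (E ▷ s) E) ⟩
          tr₃ (E ▷ s) E L      ≡⟨ tr₃-diag (E ▷ s) E s ⟩
          tr₂ (E ▷ s) (E ▷ s)  ∎

        three-loops : tr₄ L L L E ≡ 0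
        three-loops = begin
          tr₄ L L L E          ≡⟨ trans (tr₄-rotate L L L E)
                                        (trans (tr₄-rotate L L E L) (tr₄-rotate L E L L)) ⟩
          tr₄ E L L L          ≡⟨ tr₄-diag E L L s ⟩
          tr₃ E L (L ▷ s)      ≡⟨ tr₃-cong₃ E L (diag-▷ s s-idem) ⟩
          tr₃ E L L            ≡⟨ tr₃-diag E L s ⟩
          tr₂ E (L ▷ s)        ≡⟨ tr₂-cong₂ E (diag-▷ s s-idem) ⟩
          tr₂ E L              ≡⟨ tr₂-diag E s ⟩
          tr₁ (E ▷ s)          ≡⟨ trans (Σ-cong λ v → cong (_* s v) (e-irr v)) (Σ-zero n) ⟩
          0                    ∎

        four-loops : tr₄ L L L L ≡ σ G S
        four-loops = begin
          tr₄ L L L L          ≡⟨ tr₄-diag L L L s ⟩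
          tr₃ L L (L ▷ s)      ≡⟨ tr₃-cong₃ L L (diag-▷ s s-idem) ⟩
          tr₃ L L L            ≡⟨ tr₃-diag L L s ⟩
          tr₂ L (L ▷ s)        ≡⟨ tr₂-cong₂ L (diag-▷ s s-idem) ⟩
          tr₂ L L              ≡⟨ tr₂-diag L s ⟩
          tr₁ (L ▷ s)          ≡⟨ tr₁-cong (diag-▷ s s-idem) ⟩
          tr₁ L                ≡⟨ Σ-cong (λ v → trans (cong (_* s v) (δ-refl v)) (+-identityʳ (s v))) ⟩
          σ G S                ∎

        degree-split-by-S : sumN1S G S + S-edges ≡ sumDegS G S
        degree-split-by-S = begin
          Σ n (λ v → s v * n1 G S v) + Σ² (λ v w → E v w * s w * (E w v * s v))
            ≡⟨ Σ-+ _ _ ⟨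
          Σ n (λ v → s v * n1 G S v + Σ n (λ w → E v w * s w * (E w v * s v)))
            ≡⟨ Σ-cong (λ v → cong (_+ Σ n (λ w → E v w * s w * (E w v * s v))) (Σ-*ˡ (s v) _)) ⟨
          Σ n (λ v → Σ n (λ w → s v * (E v w * ι (not (inS S w)))) + Σ n (λ w → E v w * s w * (E w v * s v)))
            ≡⟨ Σ-cong (λ v → Σ-+ _ _) ⟨
          Σ² (λ v w → s v * (E v w * ι (not (inS S w))) + E v w * s w * (E w v * s v))
            ≡⟨ Σ²-cong split ⟩
          Σ² (λ v w → s v * E v w)
            ≡⟨ Σ-cong (λ v → Σ-*ˡ (s v) (E v)) ⟩
          sumDegS G S ∎
          where
          split : ∀ v w → s v * (E v w * ι (not (inS S w))) + E v w * s w * (E w v * s v) ≡ s v * E v w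
          split v w rewrite adj-sym G w v = neighbour-split (inS S v) (inS S w) (adj G v w)

        closed-walks-by-loops : wcl G S 4 ≡
          tr₄ E E E E + 4 * (2 * weighted-triangles) + 4 * sumDegS G S + 2 * S-edges + 4 * 0 + σ G S
        closed-walks-by-loops = begin
          wcl G S 4
            ≡⟨ trans (Σ-cong (closed-walks-as-trace (stepS G S))) (tr₄-cong loop-step) ⟩
          tr₄ (E ⊞ L) (E ⊞ L) (E ⊞ L) (E ⊞ L)
            ≡⟨ tr₄-binomial E L ⟩
          W + 4 * tr₄ L E E E + 4 * tr₄ L L E E + 2 * tr₄ L E L E + 4 * tr₄ L L L E + tr₄ L L L L
            ≡⟨ cong₂ (λ a b → W + 4 * a + 4 * b + 2 * tr₄ L E L E + 4 * tr₄ L L L E + tr₄ L L L L)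
                     (trans one-loop triangle-walks) adjacent-loops ⟩
          W + 4 * (2 * weighted-triangles) + 4 * sumDegS G S + 2 * tr₄ L E L E + 4 * tr₄ L L L E + tr₄ L L L L
            ≡⟨ cong₂ (λ a b → W + 4 * (2 * weighted-triangles) + 4 * sumDegS G S + 2 * a + 4 * b + tr₄ L L L L)
                     opposite-loops three-loops ⟩
          W + 4 * (2 * weighted-triangles) + 4 * sumDegS G S + 2 * S-edges + 4 * 0 + tr₄ L L L L
            ≡⟨ cong (W + 4 * (2 * weighted-triangles) + 4 * sumDegS G S + 2 * S-edges + 4 * 0 +_) four-loops ⟩
          W + 4 * (2 * weighted-triangles) + 4 * sumDegS G S + 2 * S-edges + 4 * 0 + σ G S ∎
          where
          W : ℕ
          W = tr₄ E E E E

        closed-walk-count : wcl G S 4 + 2 * size G + 2 * sumN1S G S ≡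
          σ G S + 2 * M1 G + 6 * sumDegS G S + 8 * (weighted-triangles + four-cycles)
        closed-walk-count = begin
          wcl G S 4 + 2 * size G + 2 * sumN1S G S
            ≡⟨ cong (λ w → w + 2 * size G + 2 * sumN1S G S) closed-walks-by-loops ⟩
          W + 4 * (2 * t) + 4 * sumDegS G S + 2 * S-edges + 4 * 0 + σ G S + 2 * size G + 2 * sumN1S G S
            ≡⟨ regroup W t (sumDegS G S) S-edges (σ G S) (size G) (sumN1S G S) ⟩
          (W + 2 * size G) + 8 * t + 4 * sumDegS G S + 2 * (sumN1S G S + S-edges) + σ G S
            ≡⟨ cong₂ (λ a b → a + 8 * t + 4 * sumDegS G S + 2 * b + σ G S)
                     loopless-closed-walks degree-split-by-S ⟩
          (2 * M1 G + 8 * four-cycles) + 8 * t + 4 * sumDegS G S + 2 * sumDegS G S + σ G S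
            ≡⟨ regroup′ (M1 G) four-cycles t (sumDegS G S) (σ G S) ⟩
          σ G S + 2 * M1 G + 6 * sumDegS G S + 8 * (t + four-cycles) ∎
          where
          W t : ℕ
          W = tr₄ E E E E
          t = weighted-triangles
          regroup : ∀ W t d e σ′ m N → W + 4 * (2 * t) + 4 * d + 2 * e + 4 * 0 + σ′ + 2 * m + 2 * N ≡
                                       (W + 2 * m) + 8 * t + 4 * d + 2 * (N + e) + σ′
          regroup = solve-∀
          regroup′ : ∀ M c t d σ′ →
            (2 * M + 8 * c) + 8 * t + 4 * d + 2 * d + σ′ ≡ σ′ + 2 * M + 6 * d + 8 * (t + c)
          regroup′ = solve-∀

open Counting using (closed-walk-count)
open import Data.Integer using (ℤ; +_; _+_; _-_; _*_)
open import Data.Integer.Properties using (pos-*)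
open import Data.Integer.Tactic.RingSolver using (solve-∀)

solve-for-first : ∀ (w m N σ′ M d t₁ t₂ t₃ c k : ℤ) →
  w + + 2 * m + + 2 * N ≡ σ′ + + 2 * M + + 6 * d + + 8 * (t₁ + + 2 * t₂ + + 3 * t₃ + (c + + 3 * k)) →
  w ≡ σ′ + + 2 * (M - m) + + 6 * d - + 2 * N + + 8 * (t₁ + + 2 * t₂ + + 3 * t₃ + c + + 3 * k)
solve-for-first w m N σ′ M d t₁ t₂ t₃ c k h =
  trans (isolate w m N) (trans (cong (λ x → x - + 2 * m - + 2 * N) h) (tidy m N σ′ M d t₁ t₂ t₃ c k))
  where
  isolate : ∀ w m N → w ≡ w + + 2 * m + + 2 * N - + 2 * m - + 2 * N
  isolate = solve-∀
  tidy : ∀ m N σ′ M d t₁ t₂ t₃ c k →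
    σ′ + + 2 * M + + 6 * d + + 8 * (t₁ + + 2 * t₂ + + 3 * t₃ + (c + + 3 * k)) - + 2 * m - + 2 * N
    ≡ σ′ + + 2 * (M - m) + + 6 * d - + 2 * N + + 8 * (t₁ + + 2 * t₂ + + 3 * t₃ + c + + 3 * k)
  tidy = solve-∀

integer-form : ∀ w m N σ′ M d t₁ t₂ t₃ c k →
  w ℕ.+ 2 ℕ.* m ℕ.+ 2 ℕ.* N ≡
    σ′ ℕ.+ 2 ℕ.* M ℕ.+ 6 ℕ.* d
      ℕ.+ 8 ℕ.* (t₁ ℕ.+ 2 ℕ.* t₂ ℕ.+ 3 ℕ.* t₃ ℕ.+ (c ℕ.+ 3 ℕ.* k)) →
  + w ≡ + σ′ + + 2 * (+ M - + m) + + 6 * + d - + 2 * + N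
          + + 8 * (+ t₁ + + 2 * + t₂ + + 3 * + t₃ + + c + + 3 * + k)
integer-form w m N σ′ M d t₁ t₂ t₃ c k h =
  solve-for-first (+ w) (+ m) (+ N) (+ σ′) (+ M) (+ d) (+ t₁) (+ t₂) (+ t₃) (+ c) (+ k)
    (trans (sym (cong₂ (λ a b → + w + a + b) (pos-* 2 m) (pos-* 2 N)))
    (trans (cong +_ h)
    (cong₂ _+_ (cong₂ (λ a b → + σ′ + a + b) (pos-* 2 M) (pos-* 6 d))
               (trans (pos-* 8 (t₁ ℕ.+ 2 ℕ.* t₂ ℕ.+ 3 ℕ.* t₃ ℕ.+ (c ℕ.+ 3 ℕ.* k))) (cong (+ 8 *_)
                 (cong₂ _+_ (cong₂ (λ a b → + t₁ + a + b) (pos-* 2 t₂) (pos-* 3 t₃))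
                            (cong (λ x → + c + x) (pos-* 3 k))))))))

theorem2p12 : (n : ℕ) (G : Graph n) → Connected G → 2 ≤ n → 1 ≤ size G →
    (S : Subset n) →
    + wcl G S 4 ≡
      + σ G S + + 2 * (+ M1 G - + size G) + + 6 * + sumDegS G S - + 2 * + sumN1S G S
      + + 8 * (+ nTri G S 1 + + 2 * + nTri G S 2 + + 3 * + nTri G S 3
               + + nC4 G + + 3 * + nK4 G)
theorem2p12 n G _ _ _ S =
  integer-form (wcl G S 4) (size G) (sumN1S G S) (σ G S) (M1 G) (sumDegS G S)
               (nTri G S 1) (nTri G S 2) (nTri G S 3) (nC4 G) (nK4 G) (closed-walk-count G S)
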